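{- Let $n$ be a positive integer and $n-1<s\le n$. Then $B_n(s-n+1)$ is an extreme point of $\omega_n^s$.
   Context: $\omega_n$ is the set of $n\times n$ nonnegative real matrices with all row and column sums at most $1$; $\omega_n^s$ is the set of $A\in\omega_n$ whose entries sum to $s$. For $0\le\alpha\le1$ and $m\ge1$, $B_m(\alpha)$ is the $m\times m$ matrix with every diagonal entry equal to $\alpha$, every entry in position $(i+1,i)$ ($1\le i\le m-1$) equal to $1-\alpha$, and all other entries $0$; $B_1(\alpha)=(\alpha)$. An extreme point of a convex set $C$ is a point of $C$ that is not of the form $\lambda y+(1-\lambda)z$ with $y,z\in C$, $y\ne z$, $0<\lambda<1$. -}

module Defs where

open import Level using (Level; _⊔_) renaming (suc to lsuc)
open import Data.Nat using (ℕ; zero; suc)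
import Data.Nat as N
open import Data.Fin using (Fin; toℕ)
import Data.Fin as F
open import Data.Product using (Σ; ∃; _×_; _,_)
open import Data.Sum using (_⊎_)
open import Relation.Nullary using (¬_; yes; no)
open import Relation.Binary.PropositionalEquality using (_≡_)

-- The real numbers, given axiomatically as a Dedekind-complete ordered field
-- (any model is isomorphic to ℝ).  Equality is propositional equality.
record RealField (ℓ : Level) : Set (lsuc ℓ) where
  infixl 6 _+_ _-_
  infixl 7 _*_
  infix 4 _≤_ _<_
  field
    ℝ : Set ℓ
    _+_ _*_ : ℝ → ℝ → ℝ
    -_ : ℝ → ℝ
    0ℝ 1ℝ : ℝ
    _≤_ : ℝ → ℝ → Set ℓ
    +-assoc : ∀ x y z → (x + y) + z ≡ x + (y + z)
    +-comm : ∀ x y → x + y ≡ y + x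
    +-identityˡ : ∀ x → 0ℝ + x ≡ x
    +-inverseˡ : ∀ x → (- x) + x ≡ 0ℝ
    *-assoc : ∀ x y z → (x * y) * z ≡ x * (y * z)
    *-comm : ∀ x y → x * y ≡ y * x
    *-identityˡ : ∀ x → 1ℝ * x ≡ x
    *-inverse : ∀ x → ¬ (x ≡ 0ℝ) → Σ ℝ (λ y → y * x ≡ 1ℝ)
    distribˡ : ∀ x y z → x * (y + z) ≡ (x * y) + (x * z)
    0≢1 : ¬ (0ℝ ≡ 1ℝ)
    ≤-refl : ∀ x → x ≤ x
    ≤-trans : ∀ {x y z} → x ≤ y → y ≤ z → x ≤ z
    ≤-antisym : ∀ {x y} → x ≤ y → y ≤ x → x ≡ y
    ≤-total : ∀ x y → (x ≤ y) ⊎ (y ≤ x)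
    +-mono-≤ : ∀ {x y} z → x ≤ y → x + z ≤ y + z
    *-nonneg : ∀ {x y} → 0ℝ ≤ x → 0ℝ ≤ y → 0ℝ ≤ x * y
    lub : (P : ℝ → Set ℓ) → Σ ℝ P → Σ ℝ (λ b → ∀ x → P x → x ≤ b) →
          Σ ℝ (λ u → (∀ x → P x → x ≤ u) ×
                      (∀ b → (∀ x → P x → x ≤ b) → u ≤ b))

  _<_ : ℝ → ℝ → Set ℓ
  x < y = (x ≤ y) × ¬ (x ≡ y)

  _-_ : ℝ → ℝ → ℝ
  x - y = x + (- y)

  fromℕ : ℕ → ℝ
  fromℕ zero = 0ℝ
  fromℕ (suc n) = fromℕ n + 1ℝ

  sumFin : ∀ {n} → (Fin n → ℝ) → ℝ
  sumFin {zero} f = 0ℝ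
  sumFin {suc n} f = f F.zero + sumFin (λ i → f (F.suc i))

  Matrix : ℕ → Set ℓ
  Matrix n = Fin n → Fin n → ℝ

  rowSum : ∀ {n} → Matrix n → Fin n → ℝ
  rowSum A i = sumFin (λ j → A i j)

  colSum : ∀ {n} → Matrix n → Fin n → ℝ
  colSum A j = sumFin (λ i → A i j)

  entrySum : ∀ {n} → Matrix n → ℝ
  entrySum A = sumFin (λ i → rowSum A i)

  inω : ∀ n → Matrix n → Set ℓ
  inω n A = (∀ i j → 0ℝ ≤ A i j) × (∀ i → rowSum A i ≤ 1ℝ) × (∀ j → colSum A j ≤ 1ℝ)

  inωs : ∀ n → ℝ → Matrix n → Set ℓ
  inωs n s A = inω n A × (entrySum A ≡ s)

  B : ∀ m → ℝ → Matrix m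
  B m α i j with toℕ i N.≟ toℕ j
  ... | yes _ = α
  ... | no _ with toℕ i N.≟ suc (toℕ j)
  ...   | yes _ = 1ℝ - α
  ...   | no _ = 0ℝ

  IsExtremePoint : ∀ {n} → (Matrix n → Set ℓ) → Matrix n → Set ℓ
  IsExtremePoint {n} C A =
    C A ×
    ¬ (Σ (Matrix n) λ Y → Σ (Matrix n) λ Z → Σ ℝ λ λ′ →
         C Y × C Z × ¬ (∀ i j → Y i j ≡ Z i j) ×
         (0ℝ < λ′) × (λ′ < 1ℝ) ×
         (∀ i j → A i j ≡ λ′ * Y i j + (1ℝ - λ′) * Z i j))

-- If B = λY + (1-λ)Z with Y, Z ∈ ω_n^s and 0 < λ < 1, then Y and Z vanish wherever B does,
-- so they live on the diagonal and subdiagonal.  Rows 2..n and columns 1..n-1 of B sum to 1,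
-- the largest value allowed, hence so do those of Y.  The total s = α + (n - 1) then forces
-- Y₁₁ = α, and since row k+1 and column k of Y share the entry Y_{k+1,k}, all diagonal entries
-- equal α and Y = B.  By symmetry Z = B, so Y = Z.

module Submission where

open import Defs
open import Level using (Level)
open import Data.Nat using (ℕ; zero; suc; _∸_)
import Data.Nat as ℕ
import Data.Nat.Properties as ℕₚ
open import Data.Integer as ℤ using (ℤ; +_; -[1+_])
import Data.Integer.Properties as ℤₚ
open import Data.Sign using (Sign)
open import Data.Fin using (Fin; toℕ; inject₁; _≟_) renaming (zero to fz; suc to fs; fromℕ to last)
open import Data.Fin.Properties using (toℕ-injective; toℕ-inject₁; suc-injective; inject₁-injective; fromℕ≢inject₁)
open import Data.Fin.Induction using (<-weakInduction)
import Data.Fin.Relation.Unary.Top as Top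
open import Data.Product using (_×_; _,_; proj₁; proj₂)
open import Data.Maybe using (Maybe; just; nothing)
open import Data.Sum using (_⊎_; inj₁; inj₂; [_,_]′)
open import Data.Empty using (⊥-elim)
open import Function using (_∘_)
open import Relation.Nullary using (¬_; Dec; yes; no)
open import Relation.Binary.PropositionalEquality
open import Algebra.Bundles using (CommutativeRing)
open import Algebra.Consequences.Propositional using (comm∧idˡ⇒id; comm∧invˡ⇒inv; comm∧distrˡ⇒distrʳ)
import Algebra.Solver.Ring.AlmostCommutativeRing as ACR

module RealFieldRing {ℓ} (R : RealField ℓ) where
  open RealField R

  commutativeRing : CommutativeRing ℓ ℓ
  commutativeRing = record
    { isCommutativeRing = record
      { isRing = record
        { +-isAbelianGroup = record
          { isGroup = record
            { isMonoid = record
              { isSemigroup = record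
                { isMagma = record { isEquivalence = isEquivalence ; ∙-cong = cong₂ _+_ }
                ; assoc = +-assoc }
              ; identity = comm∧idˡ⇒id +-comm +-identityˡ }
            ; inverse = comm∧invˡ⇒inv +-comm +-inverseˡ
            ; ⁻¹-cong = cong (-_) }
          ; comm = +-comm }
        ; *-cong = cong₂ _*_
        ; *-assoc = *-assoc
        ; *-identity = comm∧idˡ⇒id *-comm *-identityˡ
        ; distrib = distribˡ , comm∧distrˡ⇒distrʳ *-comm distribˡ }
      ; *-comm = *-comm } }

  open CommutativeRing commutativeRing public using (+-identityʳ; -‿inverseʳ; zeroʳ)
  open CommutativeRing commutativeRing using (ring; semiring; +-abelianGroup; +-commutativeSemigroup)
  open import Algebra.Properties.AbelianGroup +-abelianGroup public using (∙-cancelˡ; ∙-cancelʳ)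
  open import Algebra.Properties.AbelianGroup +-abelianGroup using (⁻¹-∙-comm; ε⁻¹≈ε; ⁻¹-involutive)
  open import Algebra.Properties.Ring ring using (-‿distribˡ-*; -‿distribʳ-*)
  open import Algebra.Properties.CommutativeSemigroup +-commutativeSemigroup using (interchange)
  open import Algebra.Properties.Semiring.Mult.TCOptimised semiring using (×-homo-+; ×1-homo-*; 1+×) renaming (_×_ to _·_)

  -- The solver's integer coefficients are read through the optimised multiple n · 1ℝ,
  -- for which 1 · 1ℝ reduces to 1ℝ; so con (+ 1) and con (+ 0) are literally 1ℝ and 0ℝ.
  ⟦_⟧ℤ : ℤ → ℝ
  ⟦ + n ⟧ℤ = n · 1ℝ
  ⟦ -[1+ n ] ⟧ℤ = - (suc n · 1ℝ)

  ⊖-homo : ∀ m n → ⟦ m ℤ.⊖ n ⟧ℤ ≡ m · 1ℝ - n · 1ℝ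
  ⊖-homo zero zero = sym (-‿inverseʳ 0ℝ)
  ⊖-homo (suc m) zero = sym (trans (cong (_+_ (suc m · 1ℝ)) ε⁻¹≈ε) (+-identityʳ _))
  ⊖-homo zero (suc n) = sym (+-identityˡ _)
  ⊖-homo (suc m) (suc n) = begin
    ⟦ suc m ℤ.⊖ suc n ⟧ℤ               ≡⟨ cong ⟦_⟧ℤ (ℤₚ.[1+m]⊖[1+n]≡m⊖n m n) ⟩
    ⟦ m ℤ.⊖ n ⟧ℤ                       ≡⟨ ⊖-homo m n ⟩
    a - b                              ≡⟨ sym (+-identityˡ (a - b)) ⟩
    0ℝ + (a - b)                       ≡⟨ cong (_+ (a - b)) (sym (-‿inverseʳ 1ℝ)) ⟩
    (1ℝ - 1ℝ) + (a - b)                ≡⟨ interchange 1ℝ (- 1ℝ) a (- b) ⟩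
    (1ℝ + a) + (- 1ℝ + - b)            ≡⟨ cong (_+_ (1ℝ + a)) (⁻¹-∙-comm 1ℝ b) ⟩
    (1ℝ + a) - (1ℝ + b)                ≡⟨ sym (cong₂ _-_ (1+× m 1ℝ) (1+× n 1ℝ)) ⟩
    suc m · 1ℝ - suc n · 1ℝ            ∎
    where
    open ≡-Reasoning
    a = m · 1ℝ
    b = n · 1ℝ

  +◃-homo : ∀ n → ⟦ Sign.+ ℤ.◃ n ⟧ℤ ≡ n · 1ℝ
  +◃-homo zero = refl
  +◃-homo (suc n) = refl

  -◃-homo : ∀ n → ⟦ Sign.- ℤ.◃ n ⟧ℤ ≡ - (n · 1ℝ)
  -◃-homo zero = sym ε⁻¹≈ε
  -◃-homo (suc n) = refl

  +-homo : ∀ i j → ⟦ i ℤ.+ j ⟧ℤ ≡ ⟦ i ⟧ℤ + ⟦ j ⟧ℤ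
  +-homo (+ m) (+ n) = ×-homo-+ 1ℝ m n
  +-homo (+ m) -[1+ n ] = ⊖-homo m (suc n)
  +-homo -[1+ m ] (+ n) = trans (⊖-homo n (suc m)) (+-comm _ _)
  +-homo -[1+ m ] -[1+ n ] = begin
    - (suc (suc (m ℕ.+ n)) · 1ℝ)          ≡⟨ cong (λ k → - (suc k · 1ℝ)) (sym (ℕₚ.+-suc m n)) ⟩
    - ((suc m ℕ.+ suc n) · 1ℝ)            ≡⟨ cong (-_) (×-homo-+ 1ℝ (suc m) (suc n)) ⟩
    - (suc m · 1ℝ + suc n · 1ℝ)           ≡⟨ sym (⁻¹-∙-comm _ _) ⟩
    - (suc m · 1ℝ) + - (suc n · 1ℝ)       ∎
    where open ≡-Reasoning

  *-homo : ∀ i j → ⟦ i ℤ.* j ⟧ℤ ≡ ⟦ i ⟧ℤ * ⟦ j ⟧ℤ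
  *-homo (+ m) (+ n) = trans (+◃-homo (m ℕ.* n)) (×1-homo-* m n)
  *-homo (+ m) -[1+ n ] =
    trans (-◃-homo (m ℕ.* suc n)) (trans (cong (-_) (×1-homo-* m (suc n))) (-‿distribʳ-* _ _))
  *-homo -[1+ m ] (+ n) =
    trans (-◃-homo (suc m ℕ.* n)) (trans (cong (-_) (×1-homo-* (suc m) n)) (-‿distribˡ-* _ _))
  *-homo -[1+ m ] -[1+ n ] = begin
    ⟦ + (suc m ℕ.* suc n) ⟧ℤ                 ≡⟨ trans (+◃-homo (suc m ℕ.* suc n)) (×1-homo-* (suc m) (suc n)) ⟩
    a * b                                    ≡⟨ sym (⁻¹-involutive (a * b)) ⟩
    - (- (a * b))                            ≡⟨ cong (-_) (-‿distribˡ-* a b) ⟩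
    - (- a * b)                              ≡⟨ -‿distribʳ-* (- a) b ⟩
    - a * - b                                ∎
    where
    open ≡-Reasoning
    a = suc m · 1ℝ
    b = suc n · 1ℝ

  -‿homo : ∀ i → ⟦ ℤ.- i ⟧ℤ ≡ - ⟦ i ⟧ℤ
  -‿homo (+ zero) = sym ε⁻¹≈ε
  -‿homo (+ suc n) = refl
  -‿homo -[1+ n ] = sym (⁻¹-involutive _)

  ℤ⟶ℝ : ℤ.+-*-rawRing ACR.-Raw-AlmostCommutative⟶ ACR.fromCommutativeRing commutativeRing
  ℤ⟶ℝ = record
    { ⟦_⟧ = ⟦_⟧ℤ ; +-homo = +-homo ; *-homo = *-homo ; -‿homo = -‿homo ; 0-homo = refl ; 1-homo = refl }

  ≟-coefficient : ∀ i j → Maybe (⟦ i ⟧ℤ ≡ ⟦ j ⟧ℤ)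
  ≟-coefficient i j with i ℤ.≟ j
  ... | yes refl = just refl
  ... | no _ = nothing

  open import Algebra.Solver.Ring ℤ.+-*-rawRing (ACR.fromCommutativeRing commutativeRing) ℤ⟶ℝ ≟-coefficient public
    using (solve; _:=_; _:+_; _:*_; _:-_; con)


data Band {m : ℕ} : Fin (suc m) → Fin (suc m) → Set where
  diagonal    : ∀ i → Band i i
  subdiagonal : ∀ k → Band (fs k) (inject₁ k)

inject₁≢suc : ∀ {m} (k : Fin m) → inject₁ k ≢ fs k
inject₁≢suc fz = λ ()
inject₁≢suc (fs k) e = inject₁≢suc k (suc-injective e)

Band-toℕ-diagonal : ∀ {m} {i j : Fin (suc m)} → toℕ i ≡ toℕ j → Band i j
Band-toℕ-diagonal {i = i} e = subst (Band i) (toℕ-injective e) (diagonal i)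

Band-toℕ-subdiagonal : ∀ {m} {i j : Fin (suc m)} → toℕ i ≡ suc (toℕ j) → Band i j
Band-toℕ-subdiagonal {i = fz} ()
Band-toℕ-subdiagonal {i = fs k} e =
  subst (Band (fs k)) (toℕ-injective (trans (toℕ-inject₁ k) (ℕₚ.suc-injective e))) (subdiagonal k)

Band-column-inject₁ : ∀ {m} {i j : Fin (suc m)} {k : Fin m} → Band i j → j ≡ inject₁ k → i ≡ inject₁ k ⊎ i ≡ fs k
Band-column-inject₁ (diagonal _) refl = inj₁ refl
Band-column-inject₁ (subdiagonal _) e = inj₂ (cong fs (inject₁-injective e))

Band-column-last : ∀ {m} {i j : Fin (suc m)} → Band i j → j ≡ last m → i ≡ last m
Band-column-last (diagonal _) e = e
Band-column-last (subdiagonal _) e = ⊥-elim (fromℕ≢inject₁ (sym e))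

band? : ∀ {m} (i j : Fin (suc m)) → Dec (Band i j)
band? i j with i ≟ j
... | yes refl = yes (diagonal i)
band? fz j | no i≢j = no λ { (diagonal _) → i≢j refl }
band? (fs k) j | no i≢j with j ≟ inject₁ k
... | yes refl = yes (subdiagonal k)
... | no j≢k = no λ { (diagonal _) → i≢j refl ; (subdiagonal _) → j≢k refl }

module _ {ℓ} (R : RealField ℓ) where
  open RealField R
  open RealFieldRing R

  x≤y⇒0≤y-x : ∀ {x y} → x ≤ y → 0ℝ ≤ y - x
  x≤y⇒0≤y-x {x} {y} x≤y = subst (_≤ y - x) (-‿inverseʳ x) (+-mono-≤ (- x) x≤y)

  0≤y-x⇒x≤y : ∀ {x y} → 0ℝ ≤ y - x → x ≤ y
  0≤y-x⇒x≤y {x} {y} 0≤y-x =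
    subst₂ _≤_ (+-identityˡ x) (solve 2 (λ x y → (y :- x) :+ x := y) refl x y) (+-mono-≤ x 0≤y-x)

  nonneg-+≡0⇒ˡ : ∀ {x y} → 0ℝ ≤ x → 0ℝ ≤ y → x + y ≡ 0ℝ → x ≡ 0ℝ
  nonneg-+≡0⇒ˡ {x} {y} 0≤x 0≤y x+y≡0 =
    ≤-antisym (subst₂ _≤_ (+-identityˡ x) (trans (+-comm y x) x+y≡0) (+-mono-≤ x 0≤y)) 0≤x

  *-cancelˡ-≡0 : ∀ {l x} → ¬ l ≡ 0ℝ → l * x ≡ 0ℝ → x ≡ 0ℝ
  *-cancelˡ-≡0 {l} {x} l≢0 lx≡0 with *-inverse l l≢0
  ... | l⁻¹ , l⁻¹l≡1 = begin
    x               ≡⟨ sym (*-identityˡ x) ⟩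
    1ℝ * x          ≡⟨ cong (_* x) (sym l⁻¹l≡1) ⟩
    (l⁻¹ * l) * x   ≡⟨ *-assoc l⁻¹ l x ⟩
    l⁻¹ * (l * x)   ≡⟨ cong (l⁻¹ *_) lx≡0 ⟩
    l⁻¹ * 0ℝ        ≡⟨ zeroʳ l⁻¹ ⟩
    0ℝ              ∎
    where open ≡-Reasoning

  1-[1-x]≡x : ∀ x → 1ℝ - (1ℝ - x) ≡ x
  1-[1-x]≡x = solve 1 (λ x → con (+ 1) :- (con (+ 1) :- x) := x) refl

  0<l⇒1-l<1 : ∀ {l} → 0ℝ < l → 1ℝ - l < 1ℝ
  0<l⇒1-l<1 {l} (0≤l , 0≢l) =
      0≤y-x⇒x≤y (subst (0ℝ ≤_) (sym (1-[1-x]≡x l)) 0≤l)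
    , λ 1-l≡1 → 0≢l (sym (trans (sym (1-[1-x]≡x l)) (trans (cong (_-_ 1ℝ) 1-l≡1) (-‿inverseʳ 1ℝ))))

  1-0≡1 : 1ℝ - 0ℝ ≡ 1ℝ
  1-0≡1 = solve 0 (con (+ 1) :- con (+ 0) := con (+ 1)) refl

  l<1⇒0<1-l : ∀ {l} → l < 1ℝ → 0ℝ < 1ℝ - l
  l<1⇒0<1-l {l} (l≤1 , l≢1) =
      x≤y⇒0≤y-x l≤1
    , λ 0≡1-l → l≢1 (trans (sym (1-[1-x]≡x l)) (trans (cong (_-_ 1ℝ) (sym 0≡1-l)) 1-0≡1))

  convex : ℝ → ℝ → ℝ → ℝ
  convex l a b = l * a + (1ℝ - l) * b

  convex-swap : ∀ l a b → convex l a b ≡ convex (1ℝ - l) b a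
  convex-swap = solve 3 (λ l a b → l :* a :+ (con (+ 1) :- l) :* b
                                := (con (+ 1) :- l) :* b :+ (con (+ 1) :- (con (+ 1) :- l)) :* a) refl

  convex-+ : ∀ l a b c d → convex l a b + convex l c d ≡ convex l (a + c) (b + d)
  convex-+ = solve 5 (λ l a b c d → (l :* a :+ (con (+ 1) :- l) :* b) :+ (l :* c :+ (con (+ 1) :- l) :* d)
                                 := l :* (a :+ c) :+ (con (+ 1) :- l) :* (b :+ d)) refl

  convex-0 : ∀ l → convex l 0ℝ 0ℝ ≡ 0ℝ
  convex-0 = solve 1 (λ l → l :* con (+ 0) :+ (con (+ 1) :- l) :* con (+ 0) := con (+ 0)) refl

  1-convex : ∀ l a b → 1ℝ - convex l a b ≡ convex l (1ℝ - a) (1ℝ - b)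
  1-convex = solve 3 (λ l a b → con (+ 1) :- (l :* a :+ (con (+ 1) :- l) :* b)
                             := l :* (con (+ 1) :- a) :+ (con (+ 1) :- l) :* (con (+ 1) :- b)) refl

  convex≡0⇒ˡ : ∀ {l a b} → 0ℝ < l → l < 1ℝ → 0ℝ ≤ a → 0ℝ ≤ b → convex l a b ≡ 0ℝ → a ≡ 0ℝ
  convex≡0⇒ˡ (0≤l , 0≢l) l<1 0≤a 0≤b c≡0 =
    *-cancelˡ-≡0 (λ l≡0 → 0≢l (sym l≡0))
      (nonneg-+≡0⇒ˡ (*-nonneg 0≤l 0≤a) (*-nonneg (proj₁ (l<1⇒0<1-l l<1)) 0≤b) c≡0)

  convex≡1⇒ˡ : ∀ {l a b} → 0ℝ < l → l < 1ℝ → a ≤ 1ℝ → b ≤ 1ℝ → convex l a b ≡ 1ℝ → a ≡ 1ℝ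
  convex≡1⇒ˡ {l} {a} {b} 0<l l<1 a≤1 b≤1 c≡1 = begin
    a               ≡⟨ sym (1-[1-x]≡x a) ⟩
    1ℝ - (1ℝ - a)   ≡⟨ cong (_-_ 1ℝ) 1-a≡0 ⟩
    1ℝ - 0ℝ         ≡⟨ 1-0≡1 ⟩
    1ℝ              ∎
    where
    open ≡-Reasoning
    1-a≡0 : 1ℝ - a ≡ 0ℝ
    1-a≡0 = convex≡0⇒ˡ 0<l l<1 (x≤y⇒0≤y-x a≤1) (x≤y⇒0≤y-x b≤1)
              (trans (sym (1-convex l a b)) (trans (cong (_-_ 1ℝ) c≡1) (-‿inverseʳ 1ℝ)))

  sumFin-cong : ∀ {n} {f g : Fin n → ℝ} → (∀ i → f i ≡ g i) → sumFin f ≡ sumFin g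
  sumFin-cong {zero} f≗g = refl
  sumFin-cong {suc n} f≗g = cong₂ _+_ (f≗g fz) (sumFin-cong (λ i → f≗g (fs i)))

  sumFin-zero : ∀ {n} (f : Fin n → ℝ) → (∀ i → f i ≡ 0ℝ) → sumFin f ≡ 0ℝ
  sumFin-zero {zero} f f≗0 = refl
  sumFin-zero {suc n} f f≗0 =
    trans (cong₂ _+_ (f≗0 fz) (sumFin-zero (λ i → f (fs i)) (λ i → f≗0 (fs i)))) (+-identityˡ 0ℝ)

  sumFin-single : ∀ {n} (f : Fin n → ℝ) (a : Fin n) → (∀ i → i ≢ a → f i ≡ 0ℝ) → sumFin f ≡ f a
  sumFin-single f fz off =
    trans (cong (_+_ (f fz)) (sumFin-zero (λ i → f (fs i)) (λ i → off (fs i) λ ()))) (+-identityʳ (f fz))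
  sumFin-single f (fs a) off =
    trans (cong₂ _+_ (off fz λ ()) (sumFin-single (λ i → f (fs i)) a (λ i i≢a → off (fs i) (i≢a ∘ suc-injective))))
          (+-identityˡ (f (fs a)))

  sumFin-pair : ∀ {n} (f : Fin n → ℝ) (a b : Fin n) → a ≢ b →
                (∀ i → i ≢ a → i ≢ b → f i ≡ 0ℝ) → sumFin f ≡ f a + f b
  sumFin-pair f fz fz a≢b off = ⊥-elim (a≢b refl)
  sumFin-pair f fz (fs b) a≢b off =
    cong (_+_ (f fz)) (sumFin-single (λ i → f (fs i)) b (λ i i≢b → off (fs i) (λ ()) (i≢b ∘ suc-injective)))
  sumFin-pair f (fs a) fz a≢b off =
    trans (cong (_+_ (f fz)) (sumFin-single (λ i → f (fs i)) a (λ i i≢a → off (fs i) (i≢a ∘ suc-injective) (λ ()))))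
          (+-comm (f fz) (f (fs a)))
  sumFin-pair f (fs a) (fs b) a≢b off =
    trans (cong₂ _+_ (off fz (λ ()) (λ ()))
                     (sumFin-pair (λ i → f (fs i)) a b (a≢b ∘ cong fs)
                        (λ i i≢a i≢b → off (fs i) (i≢a ∘ suc-injective) (i≢b ∘ suc-injective))))
          (+-identityˡ (f (fs a) + f (fs b)))

  sumFin-1 : ∀ n → sumFin {n} (λ _ → 1ℝ) ≡ fromℕ n
  sumFin-1 zero = refl
  sumFin-1 (suc n) = trans (cong (_+_ 1ℝ) (sumFin-1 n)) (+-comm 1ℝ (fromℕ n))

  sumFin-convex : ∀ {n} l (f g : Fin n → ℝ) → sumFin (λ i → convex l (f i) (g i)) ≡ convex l (sumFin f) (sumFin g)
  sumFin-convex {zero} l f g = sym (convex-0 l)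
  sumFin-convex {suc n} l f g =
    trans (cong (_+_ (convex l (f fz) (g fz))) (sumFin-convex l (λ i → f (fs i)) (λ i → g (fs i))))
          (convex-+ l (f fz) (g fz) _ _)

  sumFin-convex≡1⇒ˡ : ∀ {n l} {c f g : Fin n → ℝ} → 0ℝ < l → l < 1ℝ → (∀ i → c i ≡ convex l (f i) (g i)) →
                      sumFin f ≤ 1ℝ → sumFin g ≤ 1ℝ → sumFin c ≡ 1ℝ → sumFin f ≡ 1ℝ
  sumFin-convex≡1⇒ˡ {l = l} {c} {f} {g} 0<l l<1 c≗ Σf≤1 Σg≤1 Σc≡1 =
    convex≡1⇒ˡ 0<l l<1 Σf≤1 Σg≤1 (trans (sym (trans (sumFin-cong c≗) (sumFin-convex l f g))) Σc≡1)

  entrySum-rowSum-suc≡1 : ∀ {m} (M : Matrix (suc m)) → (∀ k → rowSum M (fs k) ≡ 1ℝ) →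
                          entrySum M ≡ rowSum M fz + fromℕ m
  entrySum-rowSum-suc≡1 {m} M rows≡1 = cong (_+_ (rowSum M fz)) (trans (sumFin-cong rows≡1) (sumFin-1 m))

  Banded : ∀ {m} → Matrix (suc m) → Set ℓ
  Banded M = ∀ i j → ¬ Band i j → M i j ≡ 0ℝ

  module BandedSums {m} {M : Matrix (suc m)} (M-banded : Banded M) where

    rowSum-first : rowSum M fz ≡ M fz fz
    rowSum-first = sumFin-single (M fz) fz
      λ j j≢0 → M-banded fz j λ { (diagonal _) → j≢0 refl }

    rowSum-suc : ∀ k → rowSum M (fs k) ≡ M (fs k) (inject₁ k) + M (fs k) (fs k)
    rowSum-suc k = sumFin-pair (M (fs k)) (inject₁ k) (fs k) (inject₁≢suc k)
      λ j j≢k j≢k+1 → M-banded (fs k) j λ { (diagonal _) → j≢k+1 refl ; (subdiagonal _) → j≢k refl }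

    colSum-inject₁ : ∀ k → colSum M (inject₁ k) ≡ M (inject₁ k) (inject₁ k) + M (fs k) (inject₁ k)
    colSum-inject₁ k = sumFin-pair (λ i → M i (inject₁ k)) (inject₁ k) (fs k) (inject₁≢suc k)
      λ i i≢k i≢k+1 → M-banded i (inject₁ k) λ band → [ i≢k , i≢k+1 ]′ (Band-column-inject₁ band refl)

    colSum-last : colSum M (last m) ≡ M (last m) (last m)
    colSum-last = sumFin-single (λ i → M i (last m)) (last m)
      λ i i≢last → M-banded i (last m) λ band → i≢last (Band-column-last band refl)

  module Bidiagonal (m : ℕ) (α : ℝ) where

    B-diagonal : ∀ i → B (suc m) α i i ≡ α
    B-diagonal i with toℕ i ℕ.≟ toℕ i
    ... | yes _ = refl
    ... | no i≢i = ⊥-elim (i≢i refl)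

    B-subdiagonal : ∀ k → B (suc m) α (fs k) (inject₁ k) ≡ 1ℝ - α
    B-subdiagonal k with toℕ (fs k) ℕ.≟ toℕ (inject₁ k)
    ... | yes e = ⊥-elim (ℕₚ.1+n≢n (trans e (toℕ-inject₁ k)))
    ... | no _ with toℕ (fs k) ℕ.≟ suc (toℕ (inject₁ k))
    ...   | yes _ = refl
    ...   | no ≢ = ⊥-elim (≢ (cong suc (sym (toℕ-inject₁ k))))

    B-banded : Banded (B (suc m) α)
    B-banded i j ¬band with toℕ i ℕ.≟ toℕ j
    ... | yes e = ⊥-elim (¬band (Band-toℕ-diagonal e))
    ... | no _ with toℕ i ℕ.≟ suc (toℕ j)
    ...   | yes e = ⊥-elim (¬band (Band-toℕ-subdiagonal e))
    ...   | no _ = refl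

    open BandedSums B-banded

    α+[1-α]≡1 : α + (1ℝ - α) ≡ 1ℝ
    α+[1-α]≡1 = solve 1 (λ a → a :+ (con (+ 1) :- a) := con (+ 1)) refl α

    B-rowSum-suc : ∀ k → rowSum (B (suc m) α) (fs k) ≡ 1ℝ
    B-rowSum-suc k = trans (rowSum-suc k)
      (trans (cong₂ _+_ (B-subdiagonal k) (B-diagonal (fs k))) (trans (+-comm (1ℝ - α) α) α+[1-α]≡1))

    B-colSum-inject₁ : ∀ k → colSum (B (suc m) α) (inject₁ k) ≡ 1ℝ
    B-colSum-inject₁ k = trans (colSum-inject₁ k)
      (trans (cong₂ _+_ (B-diagonal (inject₁ k)) (B-subdiagonal k)) α+[1-α]≡1)

    B-∈ωs : ∀ {s} → 0ℝ ≤ α → α ≤ 1ℝ → s ≡ α + fromℕ m → inωs (suc m) s (B (suc m) α)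
    B-∈ωs {s} 0≤α α≤1 s≡α+m = (nonneg , rows≤1 , cols≤1) , total
      where
      nonneg : ∀ i j → 0ℝ ≤ B (suc m) α i j
      nonneg i j with band? i j
      ... | yes (diagonal i) = subst (0ℝ ≤_) (sym (B-diagonal i)) 0≤α
      ... | yes (subdiagonal k) = subst (0ℝ ≤_) (sym (B-subdiagonal k)) (x≤y⇒0≤y-x α≤1)
      ... | no ¬band = subst (0ℝ ≤_) (sym (B-banded i j ¬band)) (≤-refl 0ℝ)
      rows≤1 : ∀ i → rowSum (B (suc m) α) i ≤ 1ℝ
      rows≤1 fz = subst (_≤ 1ℝ) (sym (trans rowSum-first (B-diagonal fz))) α≤1
      rows≤1 (fs k) = subst (_≤ 1ℝ) (sym (B-rowSum-suc k)) (≤-refl 1ℝ)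
      cols≤1 : ∀ j → colSum (B (suc m) α) j ≤ 1ℝ
      cols≤1 j with Top.view j
      ... | Top.‵fromℕ = subst (_≤ 1ℝ) (sym (trans colSum-last (B-diagonal (last m)))) α≤1
      ... | Top.‵inject₁ k = subst (_≤ 1ℝ) (sym (B-colSum-inject₁ k)) (≤-refl 1ℝ)
      total : entrySum (B (suc m) α) ≡ s
      total = trans (entrySum-rowSum-suc≡1 (B (suc m) α) B-rowSum-suc)
                    (trans (cong (_+ fromℕ m) (trans rowSum-first (B-diagonal fz))) (sym s≡α+m))

    module Decomposition {s} (s≡α+m : s ≡ α + fromℕ m) {Y Z : Matrix (suc m)} {l : ℝ}
      (Y∈ωs : inωs (suc m) s Y) (Z∈ωs : inωs (suc m) s Z) (0<l : 0ℝ < l) (l<1 : l < 1ℝ)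
      (B≡ : ∀ i j → B (suc m) α i j ≡ convex l (Y i j) (Z i j)) where

      Y-banded : Banded Y
      Y-banded i j ¬band = convex≡0⇒ˡ 0<l l<1 (proj₁ (proj₁ Y∈ωs) i j) (proj₁ (proj₁ Z∈ωs) i j)
                             (trans (sym (B≡ i j)) (B-banded i j ¬band))

      module YSums = BandedSums Y-banded

      Y-rowSum-suc : ∀ k → rowSum Y (fs k) ≡ 1ℝ
      Y-rowSum-suc k = sumFin-convex≡1⇒ˡ 0<l l<1 (B≡ (fs k))
        (proj₁ (proj₂ (proj₁ Y∈ωs)) (fs k)) (proj₁ (proj₂ (proj₁ Z∈ωs)) (fs k)) (B-rowSum-suc k)

      Y-colSum-inject₁ : ∀ k → colSum Y (inject₁ k) ≡ 1ℝ
      Y-colSum-inject₁ k = sumFin-convex≡1⇒ˡ 0<l l<1 (λ i → B≡ i (inject₁ k))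
        (proj₂ (proj₂ (proj₁ Y∈ωs)) (inject₁ k)) (proj₂ (proj₂ (proj₁ Z∈ωs)) (inject₁ k)) (B-colSum-inject₁ k)

      Y-first : Y fz fz ≡ α
      Y-first = ∙-cancelʳ (fromℕ m) (Y fz fz) α (begin
        Y fz fz + fromℕ m         ≡⟨ cong (_+ fromℕ m) (sym YSums.rowSum-first) ⟩
        rowSum Y fz + fromℕ m     ≡⟨ sym (entrySum-rowSum-suc≡1 Y Y-rowSum-suc) ⟩
        entrySum Y                ≡⟨ proj₂ Y∈ωs ⟩
        s                         ≡⟨ s≡α+m ⟩
        α + fromℕ m               ∎)
        where open ≡-Reasoning

      Y-diagonal : ∀ i → Y i i ≡ α
      Y-diagonal = <-weakInduction (λ i → Y i i ≡ α) Y-first λ k Yₖₖ≡α → begin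
        Y (fs k) (fs k)             ≡⟨ ∙-cancelˡ (Y (fs k) (inject₁ k)) _ _ (begin
          Y (fs k) (inject₁ k) + Y (fs k) (fs k)             ≡⟨ sym (YSums.rowSum-suc k) ⟩
          rowSum Y (fs k)                                    ≡⟨ trans (Y-rowSum-suc k) (sym (Y-colSum-inject₁ k)) ⟩
          colSum Y (inject₁ k)                               ≡⟨ YSums.colSum-inject₁ k ⟩
          Y (inject₁ k) (inject₁ k) + Y (fs k) (inject₁ k)   ≡⟨ +-comm _ _ ⟩
          Y (fs k) (inject₁ k) + Y (inject₁ k) (inject₁ k)   ∎) ⟩
        Y (inject₁ k) (inject₁ k)   ≡⟨ Yₖₖ≡α ⟩
        α                           ∎
        where open ≡-Reasoning

      Y≡B : ∀ i j → Y i j ≡ B (suc m) α i j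
      Y≡B i j with band? i j
      ... | yes (diagonal i) = trans (Y-diagonal i) (sym (B-diagonal i))
      ... | yes (subdiagonal k) = ∙-cancelˡ α _ _ (begin
        α + Y (fs k) (inject₁ k)                          ≡⟨ cong (_+ Y (fs k) (inject₁ k)) (sym (Y-diagonal (inject₁ k))) ⟩
        Y (inject₁ k) (inject₁ k) + Y (fs k) (inject₁ k)  ≡⟨ sym (YSums.colSum-inject₁ k) ⟩
        colSum Y (inject₁ k)                              ≡⟨ trans (Y-colSum-inject₁ k) (sym (B-colSum-inject₁ k)) ⟩
        colSum (B (suc m) α) (inject₁ k)                  ≡⟨ colSum-inject₁ k ⟩
        B (suc m) α (inject₁ k) (inject₁ k) + B (suc m) α (fs k) (inject₁ k)
                                                          ≡⟨ cong (_+ B (suc m) α (fs k) (inject₁ k)) (B-diagonal (inject₁ k)) ⟩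
        α + B (suc m) α (fs k) (inject₁ k)                ∎)
        where open ≡-Reasoning
      ... | no ¬band = trans (Y-banded i j ¬band) (sym (B-banded i j ¬band))

    B-isExtremePoint : ∀ {s} → 0ℝ ≤ α → α ≤ 1ℝ → s ≡ α + fromℕ m → IsExtremePoint (inωs (suc m) s) (B (suc m) α)
    B-isExtremePoint 0≤α α≤1 s≡α+m = B-∈ωs 0≤α α≤1 s≡α+m ,
      λ (Y , Z , l , Y∈ωs , Z∈ωs , Y≢Z , 0<l , l<1 , B≡) → Y≢Z λ i j → trans
        (Decomposition.Y≡B s≡α+m Y∈ωs Z∈ωs 0<l l<1 B≡ i j)
        (sym (Decomposition.Y≡B s≡α+m Z∈ωs Y∈ωs (l<1⇒0<1-l l<1) (0<l⇒1-l<1 0<l)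
                (λ i j → trans (B≡ i j) (convex-swap l (Y i j) (Z i j))) i j))

  0≤s-[f+1]+1 : ∀ {f s} → f ≤ s → 0ℝ ≤ s - (f + 1ℝ) + 1ℝ
  0≤s-[f+1]+1 {f} {s} f≤s = subst (_≤ s - (f + 1ℝ) + 1ℝ)
    (solve 1 (λ f → f :- (f :+ con (+ 1)) :+ con (+ 1) := con (+ 0)) refl f)
    (+-mono-≤ 1ℝ (+-mono-≤ (- (f + 1ℝ)) f≤s))

  s-[f+1]+1≤1 : ∀ {f s} → s ≤ f + 1ℝ → s - (f + 1ℝ) + 1ℝ ≤ 1ℝ
  s-[f+1]+1≤1 {f} {s} s≤f+1 = subst (s - (f + 1ℝ) + 1ℝ ≤_) (+-identityˡ 1ℝ)
    (+-mono-≤ 1ℝ (subst (s - (f + 1ℝ) ≤_) (-‿inverseʳ (f + 1ℝ)) (+-mono-≤ (- (f + 1ℝ)) s≤f+1)))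

  s≡[s-[f+1]+1]+f : ∀ s f → s ≡ (s - (f + 1ℝ) + 1ℝ) + f
  s≡[s-[f+1]+1]+f = solve 2 (λ s f → s := (s :- (f :+ con (+ 1)) :+ con (+ 1)) :+ f) refl

lemma4p14 : {ℓ : Level} (R : RealField ℓ) → let open RealField R in
    (n : ℕ) → 1 ℕ.≤ n → (s : ℝ) → (fromℕ (n ∸ 1) < s) × (s ≤ fromℕ n) →
    IsExtremePoint (inωs n s) (B n (s - fromℕ n + 1ℝ))
lemma4p14 R (suc m) _ s ((m≤s , _) , s≤m+1) =
  Bidiagonal.B-isExtremePoint R m (s - fromℕ (suc m) + 1ℝ)
    (0≤s-[f+1]+1 R m≤s) (s-[f+1]+1≤1 R s≤m+1) (s≡[s-[f+1]+1]+f R s (fromℕ m))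
  where open RealField R
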